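{- Let $\mathcal P=(V,\preceq)$ be a finite poset, let $\mathcal M_k$ denote the set of $k$-monotone functions $V\to\{0,1\}$, and let $f\colon V\to\{0,1\}$. Then $\mathrm{dist}(f,\mathcal M_k)=\varepsilon_f$ if and only if the minimum vertex cover of the violation hypergraph of $f$ has size $\varepsilon_f|V|$.
   Context: $f$ is $k$-monotone if there is no chain $x_1\prec\cdots\prec x_{k+1}$ with $f(x_1)=1$ and $f(x_i)\ne f(x_{i+1})$ for all $i\in[k]$. $\mathrm{dist}(f,\mathcal M_k)=\min_{g\in\mathcal M_k}|\{x:f(x)\ne g(x)\}|/|V|$. The violation hypergraph of $f$ has vertex set $V$ and a hyperedge $\{x_1,\dots,x_{k+1}\}$ for every chain $x_1\prec\cdots\prec x_{k+1}$ with $f(x_1)=1$ and $f(x_i)\ne f(x_{i+1})$ for all $i\in[k]$. A vertex cover is a set of vertices meeting every hyperedge. -}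

module Defs where

open import Level using (Level)
open import Data.Nat as ℕ using (ℕ; suc; _≤_)
open import Data.Integer using (+_)
open import Data.Rational as ℚ using (ℚ; _/_)
open import Data.Bool using (Bool; true; false; _xor_)
open import Data.Fin using (Fin; zero; suc; inject₁)
open import Data.Fin.Subset using (Subset; _∈_; ∣_∣)
open import Data.Vec using (tabulate)
open import Data.Product using (Σ; ∃; _×_)
open import Relation.Binary using (Rel; IsPartialOrder)
open import Relation.Binary.PropositionalEquality using (_≡_; _≢_)

record FinPoset (ℓ : Level) : Set (Level.suc ℓ) where
  field
    n          : ℕ
    _≼_        : Rel (Fin n) ℓ
    isPartialOrder : IsPartialOrder _≡_ _≼_

  V : Set
  V = Fin n

  _≺_ : Rel V ℓ
  x ≺ y = (x ≼ y) × (x ≢ y)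

module _ {ℓ : Level} (P : FinPoset ℓ) where
  open FinPoset P

  record ViolatingChain (k : ℕ) (f : V → Bool) : Set ℓ where
    field
      chain : Fin (suc k) → V
      increasing : (i : Fin k) → chain (inject₁ i) ≺ chain (suc i)
      startsAtOne : f (chain zero) ≡ true
      alternates : (i : Fin k) → f (chain (inject₁ i)) ≢ f (chain (suc i))

  KMonotone : ℕ → (V → Bool) → Set ℓ
  KMonotone k f = ViolatingChain k f → Data.Empty.⊥
    where import Data.Empty

  disagree : (V → Bool) → (V → Bool) → Subset n
  disagree f g = tabulate (λ x → f x xor g x)

  DistIs : .{{_ : ℕ.NonZero n}} → ℕ → (V → Bool) → ℚ → Set ℓ
  DistIs k f ε =
    (Σ (V → Bool) λ g → KMonotone k g × (ε ≡ (+ ∣ disagree f g ∣) / n))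
    × ((g : V → Bool) → KMonotone k g → ε ℚ.≤ (+ ∣ disagree f g ∣) / n)

  -- vertex covers of the violation hypergraph: every hyperedge
  -- {x₀,…,x_k} (a violating chain) meets C.
  IsVertexCover : ℕ → (V → Bool) → Subset n → Set ℓ
  IsVertexCover k f C =
    (c : ViolatingChain k f) → ∃ λ i → ViolatingChain.chain c i ∈ C

  MinVertexCoverSize : ℕ → (V → Bool) → ℕ → Set ℓ
  MinVertexCoverSize k f s =
    (Σ (Subset n) λ C → IsVertexCover k f C × ∣ C ∣ ≡ s)
    × ((C : Subset n) → IsVertexCover k f C → s ≤ ∣ C ∣)

-- If g is k-monotone, every violating chain of f must pass through a point where f and g
-- disagree, so the disagreement set of f and g is a vertex cover.  Conversely, a vertex
-- cover C of the violation hypergraph of f can be turned into a k-monotone function by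
-- reassigning the points of C one at a time: after reassigning c, one of the two values
-- at c keeps the remaining points a cover.  If both values failed, the two offending chains
-- would pass through c at positions i and j of different parity, and the first part of one
-- chain followed by the tail of the other after c is a violating chain of the original
-- function avoiding all of C.
module Submission where

open import Defs
open import Level using (Level)
open import Data.Bool using (Bool; true; false; not; _xor_)
open import Data.Bool.Properties using (¬-not; not-¬; xor-assoc; xor-same; xor-identityˡ)
open import Data.Empty using (⊥)
open import Data.Fin using (Fin; zero; suc; toℕ; fromℕ<; inject₁)
open import Data.Fin.Properties as Finₚ using (toℕ<n; toℕ≤pred[n]; toℕ-fromℕ<; toℕ-inject₁)
open import Data.Fin.Subset using (Subset; _∈_; _⊆_; ∣_∣)
open import Data.Fin.Subset.Properties using (_∈?_; ⊆-antisym; p⊆q⇒∣p∣≤∣q∣; p⊂q⇒∣p∣<∣q∣)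
open import Data.Integer as ℤ using (+_; +≤+)
import Data.Integer.Properties as ℤₚ
open import Data.List using (List; []; _∷_; filter; allFin)
open import Data.List.Membership.Propositional as List using ()
open import Data.List.Membership.Propositional.Properties using (∈-filter⁺; ∈-filter⁻; ∈-allFin)
open import Data.List.Relation.Unary.Any using (here; there)
open import Data.Nat as ℕ using (ℕ; zero; suc; _+_; _∸_; _≤_; _<_; z≤n; s≤s; _<?_; _≤?_; NonZero)
open import Data.Nat.Properties as ℕₚ
  using ( ≤-trans; ≤-reflexive; +-monoʳ-≤; <-≤-trans; <⇒≤; <⇒≢; ≤-<-trans; ≮⇒≥; ≤⇒≯; <-cmp; n∸n≡0; m∸n+n≡m; m≤n+m; +-∸-assoc
        ; m≤n⇒m⊓n≡m; m⊓n≤n; m≤n⇒m<n∨m≡n; ≤-antisym; n<1+n; <-trans)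
open import Data.Product using (Σ; ∃; _×_; _,_; proj₁; proj₂)
open import Data.Product.Function.Dependent.Propositional using (Σ-⇔)
open import Data.Product.Function.NonDependent.Propositional using (_×-⇔_)
open import Data.Rational as ℚ using (ℚ; _/_; _*_; toℚᵘ)
import Data.Rational.Properties as ℚₚ
open import Data.Rational.Unnormalised as ℚᵘ using (mkℚᵘ; *≡*; *≤*)
import Data.Rational.Unnormalised.Properties as ℚᵘₚ
open import Data.Sum using (inj₁; inj₂)
open import Data.Vec using (lookup; tabulate)
open import Data.Vec.Properties using (lookup∘tabulate; tabulate-cong; tabulate∘lookup; []=⇒lookup; lookup⇒[]=)
open import Data.Vec.Functional using (updateAt)
open import Data.Vec.Functional.Properties using (updateAt-updates; updateAt-minimal)
open import Function using (_∘_; const)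
open import Function.Bundles using (_⇔_; mk⇔; Equivalence)
open import Function.Construct.Composition using (_⇔-∘_)
open import Function.Construct.Identity using (↠-id)
open import Relation.Binary using (tri<; tri≈; tri>)
import Relation.Binary.Construct.NonStrictToStrict as Strict
open import Relation.Binary.PropositionalEquality
  using (_≡_; _≢_; refl; sym; trans; cong; subst; subst₂; ≢-sym; _≗_; module ≡-Reasoning)
open import Relation.Nullary using (¬_; Dec; yes; no; contradiction)
open import Relation.Nullary.Negation using (DoubleNegation; ¬¬-map)
open import Relation.Nullary.Decidable using (¬¬-excluded-middle; decidable-stable)

isEven : ℕ → Bool
isEven zero = true
isEven (suc n) = not (isEven n)

isEven-+-cong : ∀ {m n} → isEven m ≡ isEven n → ∀ u → isEven (u + m) ≡ isEven (u + n)
isEven-+-cong e zero = e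
isEven-+-cong e (suc u) = cong not (isEven-+-cong e u)

xor-cancelˡ : ∀ x y → x xor (x xor y) ≡ y
xor-cancelˡ x y = begin
  x xor (x xor y) ≡⟨ sym (xor-assoc x x y) ⟩
  (x xor x) xor y ≡⟨ cong (_xor y) (xor-same x) ⟩
  false xor y     ≡⟨ xor-identityˡ y ⟩
  y               ∎
  where open ≡-Reasoning

xor≡true⇒≢ : ∀ {x y} → x xor y ≡ true → x ≢ y
xor≡true⇒≢ {x} x⊕y≡true refl = contradiction (trans (sym (xor-same x)) x⊕y≡true) λ ()

xor≢true⇒≡ : ∀ {x y} → x xor y ≢ true → x ≡ y
xor≢true⇒≡ {false} {false} _ = refl
xor≢true⇒≡ {false} {true} x⊕y≢true = contradiction refl x⊕y≢true
xor≢true⇒≡ {true} {false} x⊕y≢true = contradiction refl x⊕y≢true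
xor≢true⇒≡ {true} {true} _ = refl

∈-tabulate⁺ : ∀ {n} {p : Fin n → Bool} {x} → p x ≡ true → x ∈ tabulate p
∈-tabulate⁺ {p = p} {x} px = lookup⇒[]= x (tabulate p) (trans (lookup∘tabulate p x) px)

∈-tabulate⁻ : ∀ {n} {p : Fin n → Bool} {x} → x ∈ tabulate p → p x ≡ true
∈-tabulate⁻ {p = p} {x} x∈ = trans (sym (lookup∘tabulate p x)) ([]=⇒lookup x∈)

p⊆q∧∣q∣≤∣p∣⇒p≡q : ∀ {n} {p q : Subset n} → p ⊆ q → ∣ q ∣ ≤ ∣ p ∣ → p ≡ q
p⊆q∧∣q∣≤∣p∣⇒p≡q {p = p} {q} p⊆q ∣q∣≤∣p∣ = ⊆-antisym p⊆q q⊆p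
  where
  q⊆p : q ⊆ p
  q⊆p {x} x∈q with x ∈? p
  ... | yes x∈p = x∈p
  ... | no x∉p = contradiction (p⊂q⇒∣p∣<∣q∣ (p⊆q , x , x∈q , x∉p)) (≤⇒≯ ∣q∣≤∣p∣)

toℚᵘ-/ : ∀ a m → toℚᵘ ((+ a) / suc m) ℚᵘ.≃ mkℚᵘ (+ a) m
toℚᵘ-/ a m = ℚₚ.toℚᵘ-fromℚᵘ (mkℚᵘ (+ a) m)

/-mono-≤ : ∀ {a b} n .{{_ : NonZero n}} → a ≤ b → (+ a) / n ℚ.≤ (+ b) / n
/-mono-≤ {a} {b} (suc m) a≤b = ℚₚ.toℚᵘ-cancel-≤
  (ℚᵘₚ.≤-respˡ-≃ (ℚᵘₚ.≃-sym (toℚᵘ-/ a m)) (ℚᵘₚ.≤-respʳ-≃ (ℚᵘₚ.≃-sym (toℚᵘ-/ b m))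
    (*≤* (ℤₚ.*-monoʳ-≤-nonNeg (+ suc m) (+≤+ a≤b)))))

/-cancel-≤ : ∀ {a b} n .{{_ : NonZero n}} → (+ a) / n ℚ.≤ (+ b) / n → a ≤ b
/-cancel-≤ {a} {b} (suc m) a/n≤b/n with
  ℚᵘₚ.≤-respˡ-≃ (toℚᵘ-/ a m) (ℚᵘₚ.≤-respʳ-≃ (toℚᵘ-/ b m) (ℚₚ.toℚᵘ-mono-≤ a/n≤b/n))
... | *≤* a*n≤b*n = ℤₚ.drop‿+≤+ (ℤₚ.*-cancelʳ-≤-pos (+ a) (+ b) (+ suc m) a*n≤b*n)

*[1+m]≃⇔≃/[1+m] : ∀ p s m → p ℚᵘ.* mkℚᵘ (+ suc m) 0 ℚᵘ.≃ mkℚᵘ (+ s) 0 ⇔ p ℚᵘ.≃ mkℚᵘ (+ s) m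
*[1+m]≃⇔≃/[1+m] (mkℚᵘ e d) s m = mk⇔
  (λ { (*≡* eq) → *≡* (trans (sym (ℤₚ.*-identityʳ _)) (trans eq (cong (λ z → + s ℤ.* + suc z) (ℕₚ.*-identityʳ d)))) })
  (λ { (*≡* eq) → *≡* (trans (ℤₚ.*-identityʳ _) (trans eq (cong (λ z → + s ℤ.* + suc z) (sym (ℕₚ.*-identityʳ d))))) })

≡-/⇔-*≡ : ∀ s n .{{_ : NonZero n}} (ε : ℚ) → ε ≡ (+ s) / n ⇔ (+ s) / 1 ≡ ε * ((+ n) / 1)
≡-/⇔-*≡ s (suc m) ε = mk⇔ to from
  where
  open ℚᵘₚ.≃-Reasoning
  N : ℚ
  N = (+ suc m) / 1

  toℚᵘ-ε*N : toℚᵘ (ε * N) ℚᵘ.≃ toℚᵘ ε ℚᵘ.* mkℚᵘ (+ suc m) 0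
  toℚᵘ-ε*N = ℚᵘₚ.≃-trans (ℚₚ.toℚᵘ-homo-* ε N) (ℚᵘₚ.*-congˡ {toℚᵘ ε} (toℚᵘ-/ (suc m) 0))

  to : ε ≡ (+ s) / suc m → (+ s) / 1 ≡ ε * N
  to ε≡ = ℚₚ.toℚᵘ-injective (begin
    toℚᵘ ((+ s) / 1)                 ≈⟨ toℚᵘ-/ s 0 ⟩
    mkℚᵘ (+ s) 0                     ≈⟨ ℚᵘₚ.≃-sym (Equivalence.from (*[1+m]≃⇔≃/[1+m] (toℚᵘ ε) s m) toℚᵘ-ε) ⟩
    toℚᵘ ε ℚᵘ.* mkℚᵘ (+ suc m) 0      ≈⟨ ℚᵘₚ.≃-sym toℚᵘ-ε*N ⟩
    toℚᵘ (ε * N)                     ∎)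
    where
    toℚᵘ-ε : toℚᵘ ε ℚᵘ.≃ mkℚᵘ (+ s) m
    toℚᵘ-ε = ℚᵘₚ.≃-trans (ℚₚ.toℚᵘ-cong ε≡) (toℚᵘ-/ s m)

  from : (+ s) / 1 ≡ ε * N → ε ≡ (+ s) / suc m
  from s≡ = ℚₚ.toℚᵘ-injective (begin
    toℚᵘ ε           ≈⟨ Equivalence.to (*[1+m]≃⇔≃/[1+m] (toℚᵘ ε) s m) (begin
      toℚᵘ ε ℚᵘ.* mkℚᵘ (+ suc m) 0 ≈⟨ ℚᵘₚ.≃-sym toℚᵘ-ε*N ⟩
      toℚᵘ (ε * N)                 ≈⟨ ℚₚ.toℚᵘ-cong (sym s≡) ⟩
      toℚᵘ ((+ s) / 1)             ≈⟨ toℚᵘ-/ s 0 ⟩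
      mkℚᵘ (+ s) 0                 ∎) ⟩
    mkℚᵘ (+ s) m     ≈⟨ ℚᵘₚ.≃-sym (toℚᵘ-/ s m) ⟩
    toℚᵘ ((+ s) / suc m) ∎)

module Chains {ℓ : Level} (P : FinPoset ℓ) (k : ℕ) where
  open FinPoset P

  ≺-trans : ∀ {x y z} → x ≺ y → y ≺ z → x ≺ z
  ≺-trans = Strict.<-trans _≡_ _≼_ isPartialOrder

  Increasing : (ℕ → V) → Set ℓ
  Increasing d = ∀ t → t < k → d t ≺ d (suc t)

  -- A chain is read off at positions 0, …, k, and position t carries the label isEven t;
  -- thus Chain (Valued h) is a violating chain of h, and R may add side conditions.
  Labelled : (Bool → V → Set) → (ℕ → V) → Set
  Labelled R d = ∀ t → t ≤ k → R (isEven t) (d t)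

  LabelledExcept : (Bool → V → Set) → (ℕ → V) → ℕ → Set
  LabelledExcept R d i = ∀ t → t ≤ k → t ≢ i → R (isEven t) (d t)

  Chain : (Bool → V → Set) → Set ℓ
  Chain R = Σ (ℕ → V) λ d → Increasing d × Labelled R d

  increasing⇒≺ : ∀ {d} → Increasing d → ∀ {t u} → t < u → u ≤ k → d t ≺ d u
  increasing⇒≺ inc {t} {suc u} t<1+u 1+u≤k with m≤n⇒m<n∨m≡n (ℕ.s≤s⁻¹ t<1+u)
  ... | inj₁ t<u = ≺-trans (increasing⇒≺ inc t<u (<⇒≤ 1+u≤k)) (inc u 1+u≤k)
  ... | inj₂ refl = inc t 1+u≤k

  increasing-injective : ∀ {d} → Increasing d → ∀ {t u} → t ≤ k → u ≤ k → d t ≡ d u → t ≡ u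
  increasing-injective inc {t} {u} t≤k u≤k dt≡du with <-cmp t u
  ... | tri< t<u _ _ = contradiction dt≡du (proj₂ (increasing⇒≺ inc t<u u≤k))
  ... | tri≈ _ t≡u _ = t≡u
  ... | tri> _ _ u<t = contradiction (sym dt≡du) (proj₂ (increasing⇒≺ inc u<t t≤k))

  -- The first q points of a followed by the points of b after position p; the point
  -- a q = b p itself is skipped, and the parity condition keeps the labels in phase.
  splice : ∀ {R a b p q} → p < q → q ≤ k → a q ≡ b p → isEven p ≢ isEven q →
           Increasing a → Increasing b → LabelledExcept R a q → LabelledExcept R b p → Chain R
  splice {R} {a} {b} {p} {q} p<q q≤k aq≡bp p≢q inc-a inc-b lab-a lab-b =
    (λ t → piece t (t <? q)) , (λ t t<k → step t<k (t <? q) (suc t <? q)) , labelled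
    where
    shift : ℕ → ℕ
    shift t = (t ∸ q) + suc p

    shift≤ : ∀ {t} → q ≤ t → shift t ≤ t
    shift≤ {t} q≤t = ≤-trans (+-monoʳ-≤ (t ∸ q) p<q) (≤-reflexive (m∸n+n≡m q≤t))

    shift≢p : ∀ t → shift t ≢ p
    shift≢p t = ≢-sym (<⇒≢ (m≤n+m (suc p) (t ∸ q)))

    isEven-shift : ∀ {t} → q ≤ t → isEven (shift t) ≡ isEven t
    isEven-shift {t} q≤t =
      trans (isEven-+-cong (sym (¬-not (≢-sym p≢q))) (t ∸ q)) (cong isEven (m∸n+n≡m q≤t))

    piece : ∀ t → Dec (t < q) → V
    piece t (yes _) = a t
    piece t (no _) = b (shift t)

    labelled : Labelled R (λ t → piece t (t <? q))
    labelled t t≤k with t <? q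
    ... | yes t<q = lab-a t t≤k (<⇒≢ t<q)
    ... | no t≮q = subst (λ e → R e (b (shift t))) (isEven-shift (≮⇒≥ t≮q))
                     (lab-b (shift t) (≤-trans (shift≤ (≮⇒≥ t≮q)) t≤k) (shift≢p t))

    step : ∀ {t} → t < k → (d : Dec (t < q)) (d′ : Dec (suc t < q)) → piece t d ≺ piece (suc t) d′
    step t<k (yes _) (yes _) = inc-a _ t<k
    step {t} t<k (yes t<q) (no 1+t≮q) = subst (λ u → a t ≺ b u) (sym shift[1+t]≡1+p)
      (≺-trans (subst (λ u → a t ≺ a u) 1+t≡q (inc-a t t<k))
               (subst (_≺ b (suc p)) (sym aq≡bp) (inc-b p (<-≤-trans p<q q≤k))))
      where
      1+t≡q : suc t ≡ q
      1+t≡q = ≤-antisym t<q (≮⇒≥ 1+t≮q)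
      shift[1+t]≡1+p : shift (suc t) ≡ suc p
      shift[1+t]≡1+p = trans (cong shift 1+t≡q) (cong (_+ suc p) (n∸n≡0 q))
    step t<k (no t≮q) (yes 1+t<q) = contradiction (<-trans (n<1+n _) 1+t<q) t≮q
    step {t} t<k (no t≮q) (no _) = subst (λ u → b (shift t) ≺ b u) (sym shift-suc)
      (inc-b (shift t) (≤-<-trans (shift≤ (≮⇒≥ t≮q)) t<k))
      where
      shift-suc : shift (suc t) ≡ suc (shift t)
      shift-suc = cong (_+ suc p) (+-∸-assoc 1 (≮⇒≥ t≮q))

  splice-≢ : ∀ {R a b i j} → Increasing a → Increasing b → i ≤ k → j ≤ k → a i ≡ b j →
             isEven i ≢ isEven j → LabelledExcept R a i → LabelledExcept R b j → Chain R
  splice-≢ {R} {i = i} {j} inc-a inc-b i≤k j≤k ai≡bj i≢j lab-a lab-b with <-cmp i j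
  ... | tri< i<j _ _ = splice {R} i<j j≤k (sym ai≡bj) i≢j inc-b inc-a lab-b lab-a
  ... | tri≈ _ refl _ = contradiction refl i≢j
  ... | tri> _ _ j<i = splice {R} j<i i≤k ai≡bj (≢-sym i≢j) inc-a inc-b lab-a lab-b

  Valued : (V → Bool) → Bool → V → Set
  Valued h b x = h x ≡ b

  chain⇒violatingChain : ∀ {h} → Chain (Valued h) → ViolatingChain P k h
  chain⇒violatingChain {h} (d , inc , lab) = record
    { chain = d ∘ toℕ
    ; increasing = λ i → subst (λ t → d t ≺ d (suc (toℕ i))) (sym (toℕ-inject₁ i)) (inc (toℕ i) (toℕ<n i))
    ; startsAtOne = lab 0 z≤n
    ; alternates = λ i → subst₂ _≢_ (sym (value (inject₁ i))) (sym (value (suc i)))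
        (subst (λ t → isEven t ≢ not (isEven (toℕ i))) (sym (toℕ-inject₁ i)) (not-¬ refl))
    }
    where
    value : ∀ (j : Fin (suc k)) → h (d (toℕ j)) ≡ isEven (toℕ j)
    value j = lab (toℕ j) (toℕ≤pred[n] j)

  violatingChain⇒chain : ∀ {h} → ViolatingChain P k h → Chain (Valued h)
  violatingChain⇒chain {h} vc = chain ∘ clamp , increasing′ , value
    where
    open ViolatingChain vc

    clamp : ℕ → Fin (suc k)
    clamp t = fromℕ< (s≤s (m⊓n≤n t k))

    clamp-toℕ : ∀ {t} → t ≤ k → toℕ (clamp t) ≡ t
    clamp-toℕ t≤k = trans (toℕ-fromℕ< _) (m≤n⇒m⊓n≡m t≤k)

    clamp-inject₁ : ∀ {t} (t<k : t < k) → clamp t ≡ inject₁ (fromℕ< t<k)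
    clamp-inject₁ t<k = Finₚ.toℕ-injective
      (trans (clamp-toℕ (<⇒≤ t<k)) (sym (trans (toℕ-inject₁ _) (toℕ-fromℕ< t<k))))

    clamp-suc : ∀ {t} (t<k : t < k) → clamp (suc t) ≡ suc (fromℕ< t<k)
    clamp-suc t<k = Finₚ.toℕ-injective (trans (clamp-toℕ t<k) (sym (cong suc (toℕ-fromℕ< t<k))))

    increasing′ : Increasing (chain ∘ clamp)
    increasing′ t t<k = subst₂ (λ x y → chain x ≺ chain y)
      (sym (clamp-inject₁ t<k)) (sym (clamp-suc t<k)) (increasing (fromℕ< t<k))

    value : Labelled (Valued h) (chain ∘ clamp)
    value zero _ = startsAtOne
    value (suc t) t<k = begin
      h (chain (clamp (suc t)))        ≡⟨ cong (h ∘ chain) (clamp-suc t<k) ⟩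
      h (chain (suc i))                ≡⟨ ¬-not (≢-sym (alternates i)) ⟩
      not (h (chain (inject₁ i)))      ≡⟨ cong (not ∘ h ∘ chain) (sym (clamp-inject₁ t<k)) ⟩
      not (h (chain (clamp t)))        ≡⟨ cong not (value t (<⇒≤ t<k)) ⟩
      not (isEven t)                   ∎
      where
      open ≡-Reasoning
      i : Fin k
      i = fromℕ< t<k

  Outside : (V → Bool) → List V → Bool → V → Set
  Outside h xs b x = h x ≡ b × x List.∉ xs

  -- xs meets every violating chain of h.  As _≼_ is not decidable, covering is only
  -- available negatively, and the reassignments below are made under a double negation.
  Covers : List V → (V → Bool) → Set ℓ
  Covers xs h = ¬ Chain (Outside h xs)

  _[_≔_] : (V → Bool) → V → Bool → V → Bool
  h [ c ≔ b ] = updateAt h c (const b)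

  module _ {h : V → Bool} {c : V} {xs : List V} (cover : Covers (c ∷ xs) h) where

    outside-∷ : ∀ {b e x} → x ≢ c → Outside (h [ c ≔ b ]) xs e x → Outside h (c ∷ xs) e x
    outside-∷ {x = x} x≢c (hx≡e , x∉xs) =
      trans (sym (updateAt-minimal x c h x≢c)) hx≡e , λ { (here x≡c) → x≢c x≡c ; (there x∈xs) → x∉xs x∈xs }

    passes-through : ∀ {b d} → Increasing d → Labelled (Outside (h [ c ≔ b ]) xs) d →
      DoubleNegation (∃ λ i → i ≤ k × d i ≡ c × isEven i ≡ b × LabelledExcept (Outside h (c ∷ xs)) d i)
    passes-through {b} {d} inc lab ¬through = cover (d , inc , λ t t≤k →
      outside-∷ (λ dt≡c → ¬through (t , t≤k , dt≡c , parity t≤k dt≡c , except t≤k dt≡c)) (lab t t≤k))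
      where
      parity : ∀ {t} → t ≤ k → d t ≡ c → isEven t ≡ b
      parity {t} t≤k dt≡c =
        trans (sym (proj₁ (lab t t≤k))) (trans (cong (h [ c ≔ b ]) dt≡c) (updateAt-updates c h))

      except : ∀ {t} → t ≤ k → d t ≡ c → LabelledExcept (Outside h (c ∷ xs)) d t
      except t≤k dt≡c u u≤k u≢t = outside-∷
        (λ du≡c → u≢t (increasing-injective inc u≤k t≤k (trans du≡c (sym dt≡c)))) (lab u u≤k)

    conflict : Chain (Outside (h [ c ≔ true ]) xs) → Chain (Outside (h [ c ≔ false ]) xs) → ⊥
    conflict (d₁ , inc₁ , lab₁) (d₂ , inc₂ , lab₂) =
      passes-through inc₁ lab₁ λ (i , i≤k , d₁i≡c , even-i , lab₁′) →
      passes-through inc₂ lab₂ λ (j , j≤k , d₂j≡c , odd-j , lab₂′) →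
      cover (splice-≢ {Outside h (c ∷ xs)} inc₁ inc₂ i≤k j≤k (trans d₁i≡c (sym d₂j≡c))
                      (subst₂ _≢_ (sym even-i) (sym odd-j) λ ()) lab₁′ lab₂′)

    reassign : DoubleNegation (∃ λ b → Covers xs (h [ c ≔ b ]))
    reassign ¬reassigned = ¬¬-excluded-middle {A = Covers xs (h [ c ≔ true ])} λ
      { (yes covers) → ¬reassigned (true , covers)
      ; (no ¬covers) → ¬reassigned (false , λ chain₂ → ¬covers (λ chain₁ → conflict chain₁ chain₂)) }

  repair : ∀ xs {h} → Covers xs h →
           DoubleNegation (∃ λ h′ → Covers [] h′ × (∀ x → x List.∉ xs → h′ x ≡ h x))
  repair [] cover ¬repaired = ¬repaired (_ , cover , λ _ _ → refl)
  repair (c ∷ xs) {h} cover ¬repaired =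
    reassign cover λ (b , cover′) →
    repair xs cover′ λ (h′ , covers , agrees) →
    ¬repaired (h′ , covers , λ x x∉ → trans (agrees x (x∉ ∘ there)) (updateAt-minimal x c h (x∉ ∘ here)))

module _ {ℓ : Level} (P : FinPoset ℓ) (k : ℕ) where
  open FinPoset P
  open Chains P k

  violatingChain-resp : ∀ {g h} (vc : ViolatingChain P k g) →
    (∀ i → g (ViolatingChain.chain vc i) ≡ h (ViolatingChain.chain vc i)) → ViolatingChain P k h
  violatingChain-resp vc g≡h = record
    { chain = chain
    ; increasing = increasing
    ; startsAtOne = trans (sym (g≡h zero)) startsAtOne
    ; alternates = λ i → subst₂ _≢_ (g≡h (inject₁ i)) (g≡h (suc i)) (alternates i)
    }
    where open ViolatingChain vc

  kMonotone-resp-≗ : ∀ {g h} → g ≗ h → KMonotone P k g → KMonotone P k h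
  kMonotone-resp-≗ g≗h mono vc = mono (violatingChain-resp vc (sym ∘ g≗h ∘ ViolatingChain.chain vc))

  covers-[]⇒kMonotone : ∀ {h} → Covers [] h → KMonotone P k h
  covers-[]⇒kMonotone cover vc with violatingChain⇒chain vc
  ... | d , inc , lab = cover (d , inc , λ t t≤k → lab t t≤k , λ ())

  members : Subset n → List V
  members C = filter (_∈? C) (allFin n)

  isVertexCover⇒covers : ∀ {h C} → IsVertexCover P k h C → Covers (members C) h
  isVertexCover⇒covers {C = C} cover (d , inc , lab)
    with cover (chain⇒violatingChain (d , inc , λ t t≤k → proj₁ (lab t t≤k)))
  ... | i , dᵢ∈C = proj₂ (lab (toℕ i) (toℕ≤pred[n] i)) (∈-filter⁺ (_∈? C) (∈-allFin _) dᵢ∈C)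

  module _ (f : V → Bool) where

    toggle : Subset n → V → Bool
    toggle C x = f x xor lookup C x

    disagree-toggle : ∀ C → disagree P f (toggle C) ≡ C
    disagree-toggle C = trans (tabulate-cong (λ x → xor-cancelˡ (f x) (lookup C x))) (tabulate∘lookup C)

    toggle-disagree : ∀ g → toggle (disagree P f g) ≗ g
    toggle-disagree g x = trans (cong (f x xor_) (lookup∘tabulate _ x)) (xor-cancelˡ (f x) (g x))

    disagreement-covers : ∀ {g} → KMonotone P k g → IsVertexCover P k f (disagree P f g)
    disagreement-covers {g} mono vc with Finₚ.any? (λ i → ViolatingChain.chain vc i ∈? disagree P f g)
    ... | yes meets = meets
    ... | no ¬meets = contradiction
      (violatingChain-resp vc λ i → xor≢true⇒≡ (λ f⊕g≡true → ¬meets (i , ∈-tabulate⁺ f⊕g≡true))) mono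

    repair-cover : ∀ {C} → IsVertexCover P k f C →
                   DoubleNegation (∃ λ g → KMonotone P k g × disagree P f g ⊆ C)
    repair-cover {C} cover = ¬¬-map witness (repair (members C) (isVertexCover⇒covers cover))
      where
      witness : (∃ λ g → Covers [] g × (∀ x → x List.∉ members C → g x ≡ f x)) →
                ∃ λ g → KMonotone P k g × disagree P f g ⊆ C
      witness (g , covers , agrees) = g , covers-[]⇒kMonotone covers , λ {x} x∈D →
        decidable-stable (x ∈? C) λ x∉C →
          xor≡true⇒≢ (∈-tabulate⁻ x∈D) (sym (agrees x (x∉C ∘ proj₂ ∘ ∈-filter⁻ (_∈? C) {xs = allFin n})))

    MinDisagreement : ℕ → Set ℓ
    MinDisagreement s = (Σ (V → Bool) λ g → KMonotone P k g × ∣ disagree P f g ∣ ≡ s)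
                      × (∀ g → KMonotone P k g → s ≤ ∣ disagree P f g ∣)

    minDisagreement⇔minVertexCoverSize : ∀ s → MinDisagreement s ⇔ MinVertexCoverSize P k f s
    minDisagreement⇔minVertexCoverSize s = mk⇔ to from
      where
      to : MinDisagreement s → MinVertexCoverSize P k f s
      to ((g , mono , ∣D∣≡s) , minimal) = (disagree P f g , disagreement-covers mono , ∣D∣≡s) , smallest
        where
        smallest : ∀ C → IsVertexCover P k f C → s ≤ ∣ C ∣
        smallest C cover = decidable-stable (s ≤? ∣ C ∣) (¬¬-map
          (λ (g′ , mono′ , D⊆C) → ≤-trans (minimal g′ mono′) (p⊆q⇒∣p∣≤∣q∣ D⊆C)) (repair-cover cover))

      from : MinVertexCoverSize P k f s → MinDisagreement s
      from ((C , cover , ∣C∣≡s) , minimal) =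
        (toggle C , mono , trans (cong ∣_∣ (disagree-toggle C)) ∣C∣≡s) ,
        λ g mono′ → minimal _ (disagreement-covers mono′)
        where
        -- By minimality of C, a k-monotone g′ disagreeing with f only inside C
        -- disagrees with f on all of C, so g′ is toggle C.
        mono : KMonotone P k (toggle C)
        mono vc = repair-cover cover λ (g′ , mono′ , D⊆C) →
          let D≡C = p⊆q∧∣q∣≤∣p∣⇒p≡q D⊆C (subst (_≤ _) (sym ∣C∣≡s) (minimal _ (disagreement-covers mono′)))
          in kMonotone-resp-≗ (λ x → trans (sym (toggle-disagree g′ x)) (cong (λ D → toggle D x) D≡C)) mono′ vc

    distIs⇔minDisagreement : .{{_ : NonZero n}} (ε : ℚ) →
                             DistIs P k f ε ⇔ (Σ ℕ λ s → MinDisagreement s × ε ≡ (+ s) / n)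
    distIs⇔minDisagreement ε = mk⇔ to from
      where
      to : DistIs P k f ε → Σ ℕ λ s → MinDisagreement s × ε ≡ (+ s) / n
      to ((g , mono , ε≡) , minimal) =
        ∣ disagree P f g ∣ ,
        ((g , mono , refl) , λ g′ mono′ → /-cancel-≤ n (subst (ℚ._≤ _) ε≡ (minimal g′ mono′))) ,
        ε≡

      from : (Σ ℕ λ s → MinDisagreement s × ε ≡ (+ s) / n) → DistIs P k f ε
      from (s , ((g , mono , ∣D∣≡s) , minimal) , ε≡) =
        (g , mono , trans ε≡ (cong (λ s → (+ s) / n) (sym ∣D∣≡s))) ,
        λ g′ mono′ → subst (ℚ._≤ _) (sym ε≡) (/-mono-≤ n (minimal g′ mono′))

lemmaB9 : {ℓ : Level} (P : FinPoset ℓ) .{{_ : NonZero (FinPoset.n P)}}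
          (k : ℕ) (f : Fin (FinPoset.n P) → Bool) (ε : ℚ) →
          DistIs P k f ε ⇔
            (Σ ℕ λ s → MinVertexCoverSize P k f s
              × ((+ s) / 1 ≡ ε * ((+ FinPoset.n P) / 1)))
lemmaB9 P k f ε =
  Σ-⇔ (↠-id ℕ) (λ {s} → minDisagreement⇔minVertexCoverSize P k f s ×-⇔ ≡-/⇔-*≡ s (FinPoset.n P) ε)
  ⇔-∘ distIs⇔minDisagreement P k f ε
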